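{- Let $u<v$ be two Markov irrationalities that are neighbors. Then $\textit{b-match}(u,v)=\ell(v)-2$ and $\textit{f-match}(u,v)=\ell(u)-2$.
   Context: For a purely periodic quadratic irrational $w$, $\ell(w)$ is the minimal even length of a period of its continued fraction. For distinct purely periodic $x,y$, write $x=[\overline{c_1;\ldots,c_N}]$, $y=[\overline{d_1;\ldots,d_N}]$ with a common even period length $N$ (repeating periods if necessary). Then $\textit{b-match}(x,y)=k$ means $c_N=d_N,\ldots,c_{N-k+1}=d_{N-k+1}$ and $c_{N-k}\ne d_{N-k}$ (matching partial quotients counted from the back), and $\textit{f-match}(x,y)=k$ means $c_1=d_1,\ldots,c_k=d_k$ and $c_{k+1}\ne d_{k+1}$. Markov irrationalities: for $u=[\overline{a_1;\ldots,a_r}]$, $v=[\overline{b_1;\ldots,b_s}]$ with minimal even periods, $u\odot v=[\overline{a_1;\ldots,a_r,b_1,\ldots,b_s}]$. Fractions $a/b<c/d$ in $[0,1/2]$ are neighbors if $bc-ad=1$; every rational in $(0,1/2)$ is the mediant $(a+c)/(b+d)$ of a unique pair of neighbors. Define $w(0/1)=[\overline{1;1}]$, $w(1/2)=[\overline{2;2}]$, $w\big(\frac{a+c}{b+d}\big)=w(c/d)\odot w(a/b)$ for neighbors $a/b<c/d$; the values are the Markov irrationalities, and two of them are neighbors if their parameters are neighbors. -}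

module Defs where

open import Data.Nat using (ℕ; zero; suc; _+_; _*_; _∸_; _≤_; _<_)
open import Data.Nat.DivMod using (_%_)
open import Data.Nat.Divisibility using (_∣_)
open import Data.List using (List; []; _∷_; length; _++_; applyUpTo)
open import Data.Product using (Σ; _×_)
open import Data.Sum using (_⊎_)
open import Relation.Binary.PropositionalEquality using (_≡_; _≢_)
open import Relation.Nullary using (¬_)

-- Infinite sequence of partial quotients, 0-indexed: s 0 = c_1 (the integer part).
Seq : Set
Seq = ℕ → ℕ

-- i-th entry of a list (0 if out of range; never used out of range below)
nth : List ℕ → ℕ → ℕ
nth []       _       = 0
nth (x ∷ xs) zero    = x
nth (x ∷ xs) (suc i) = nth xs i

-- The purely periodic continued fraction [ \overline{ P } ] as its sequence of
-- partial quotients.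
cyc : List ℕ → Seq
cyc []       i = 0
cyc (x ∷ xs) i = nth (x ∷ xs) (i % suc (length xs))

Periodic : Seq → ℕ → Set
Periodic s N = ∀ i → s (N + i) ≡ s i

IsEll : Seq → ℕ → Set
IsEll s N = (0 < N) × (2 ∣ N) × Periodic s N
          × (∀ M → 0 < M → 2 ∣ M → Periodic s M → N ≤ M)

MinBlock : List ℕ → List ℕ → Set
MinBlock P B = Σ ℕ λ N → IsEll (cyc P) N × (B ≡ applyUpTo (cyc P) N)

-- a/b < c/d are neighbors in [0,1/2]: b,d > 0, bc - ad = 1, c/d ≤ 1/2
-- (a/b ≥ 0 is automatic for naturals; a/b < c/d follows from bc - ad = 1).
Neighbors : ℕ → ℕ → ℕ → ℕ → Set
Neighbors a b c d = (0 < b) × (0 < d) × (b * c ≡ a * d + 1) × (2 * c ≤ d)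

-- W a b P : the Markov irrationality w(a/b) equals [ \overline{ P } ].
-- w(0/1) = [1;1], w(1/2) = [2;2], w((a+c)/(b+d)) = w(c/d) ⊙ w(a/b) for neighbors,
-- where ⊙ concatenates the minimal even period blocks.
data W : ℕ → ℕ → List ℕ → Set where
  w0   : W 0 1 (1 ∷ 1 ∷ [])
  w12  : W 1 2 (2 ∷ 2 ∷ [])
  wmed : ∀ {a b c d P Q A B} → Neighbors a b c d → W a b P → W c d Q →
         MinBlock Q A → MinBlock P B → W (a + c) (b + d) (A ++ B)

-- Order of (irrational) continued fractions via their partial quotients:
-- at the first differing index k (0-based), s < t iff s k < t k when k is even,
-- and s k > t k when k is odd.
CFLess : Seq → Seq → Set
CFLess s t = Σ ℕ λ k → (∀ i → i < k → s i ≡ t i)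
           × ((2 ∣ k × s k < t k) ⊎ (¬ (2 ∣ k) × t k < s k))

FMatch : Seq → Seq → ℕ → Set
FMatch s t k = (∀ i → i < k → s i ≡ t i) × (s k ≢ t k)

-- b-match(x,y) = k : for a common even period length N,
-- c_N = d_N, …, c_{N-k+1} = d_{N-k+1} and c_{N-k} ≠ d_{N-k}
-- (1-indexed c_m is s (m ∸ 1), so c_{N-j} = s (N ∸ suc j)).
BMatch : Seq → Seq → ℕ → Set
BMatch s t k = Σ ℕ λ N → (0 < N) × (2 ∣ N) × Periodic s N × Periodic t N × (k < N)
             × (∀ j → j < k → s (N ∸ suc j) ≡ t (N ∸ suc j))
             × (s (N ∸ suc k) ≢ t (N ∸ suc k))

{-# OPTIONS --safe #-}
module Submission where

-- Let P and Q be the period blocks of the neighbors w(a/b) < w(c/d). By induction along the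
-- Farey tree, cyc P and cyc Q first differ at position |P| − 2 (P reads 1, Q reads 2), and read
-- backwards they first differ at position |Q| − 2 (Q reads 2, P reads 1). In the inductive step
-- the neighbor with the larger denominator is, by uniqueness of the neighbor decomposition, the
-- mediant of the other one and of a neighbor of it, so its block is Q ++ P₁ (or Q₂ ++ P); and if
-- X agrees with cyc Y up to |X| − 2, then Y ++ X agrees with cyc Y up to |Y| + |X| − 2, because
-- |Y| is a period of cyc Y. The blocks are primitive: |P| = 2(b − a) and the entries of P at even
-- positions sum to b, so if P consisted of q copies of its minimal even period, q would divide b
-- and b − a, hence q = 1 as gcd(a, b) = 1. Thus ℓ(u) = |P| and ℓ(v) = |Q|, which gives both
-- matches; with the parameters ordered the other way, the first difference at the even position
-- |Q| − 2 would put v below u.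

open import Defs
open import Data.Nat using (ℕ; zero; suc; _+_; _*_; _∸_; _≤_; _<_; z≤n; s≤s; >-nonZero)
open import Data.Nat.Properties
open import Data.Nat.DivMod using (_%_; _/_; m≡m%n+[m/n]*n; m%n<n; m<n⇒m%n≡m; [m+n]%n≡m%n)
open import Data.Nat.Divisibility using (_∣_; divides; ∣m+n∣m⇒∣n; ∣m⇒∣m*n; ∣n⇒∣m*n; m∣m*n; n∣m*n; n∣n; ∣1⇒≡1; >⇒∤; m%n≡0⇒n∣m)
open import Data.Nat.Coprimality using (Coprime; coprime-divisor) renaming (sym to Coprime-sym)
open import Data.Nat.Tactic.RingSolver using (solve)
open import Data.List using (List; []; _∷_; length; _++_; applyUpTo; reverse)
open import Data.List.Properties using (length-++; length-reverse; unfold-reverse; reverse-++)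
open import Data.Product using (∃; _×_; _,_; proj₁; proj₂)
open import Data.Sum using (_⊎_; inj₁; inj₂)
open import Data.Empty using (⊥-elim)
open import Relation.Nullary using (¬_)
open import Relation.Binary.PropositionalEquality
open import Relation.Binary.Definitions using (tri<; tri≈; tri>)
open import Function using (_∘_)

<⊎≡+ : ∀ n i → i < n ⊎ ∃ λ j → i ≡ n + j
<⊎≡+ zero    i       = inj₂ (i , refl)
<⊎≡+ (suc n) zero    = inj₁ (s≤s z≤n)
<⊎≡+ (suc n) (suc i) with <⊎≡+ n i
... | inj₁ i<n       = inj₁ (s≤s i<n)
... | inj₂ (j , i≡n+j) = inj₂ (j , cong suc i≡n+j)

nth-++ˡ : ∀ xs ys {i} → i < length xs → nth (xs ++ ys) i ≡ nth xs i
nth-++ˡ (x ∷ xs) ys {zero}  _         = refl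
nth-++ˡ (x ∷ xs) ys {suc i} (s≤s i<n) = nth-++ˡ xs ys i<n

nth-++ʳ : ∀ xs ys j → nth (xs ++ ys) (length xs + j) ≡ nth ys j
nth-++ʳ []       ys j = refl
nth-++ʳ (x ∷ xs) ys j = nth-++ʳ xs ys j

nth-reverse : ∀ xs {r} → r < length xs → nth (reverse xs) r ≡ nth xs (length xs ∸ suc r)
nth-reverse (x ∷ xs) {r} r<n rewrite unfold-reverse x xs with <-cmp r (length xs)
... | tri< r<m _ _ = begin
  nth (reverse xs ++ x ∷ []) r           ≡⟨ nth-++ˡ (reverse xs) _ (subst (r <_) (sym (length-reverse xs)) r<m) ⟩
  nth (reverse xs) r                     ≡⟨ nth-reverse xs r<m ⟩
  nth xs (length xs ∸ suc r)             ≡⟨ cong (nth (x ∷ xs)) (+-∸-assoc 1 r<m) ⟨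
  nth (x ∷ xs) (suc (length xs) ∸ suc r) ∎
  where open ≡-Reasoning
... | tri≈ _ refl _ rewrite n∸n≡0 (length xs) =
  subst (λ n → nth (reverse xs ++ x ∷ []) n ≡ x) (length-reverse xs) (nth-++-length (reverse xs))
  where
  nth-++-length : ∀ ys → nth (ys ++ x ∷ []) (length ys) ≡ x
  nth-++-length []       = refl
  nth-++-length (y ∷ ys) = nth-++-length ys
... | tri> _ _ r>m = ⊥-elim (<-irrefl refl (≤-trans r<n r>m))

cyc-nth : ∀ xs {i} → i < length xs → cyc xs i ≡ nth xs i
cyc-nth (x ∷ xs) i<n = cong (nth (x ∷ xs)) (m<n⇒m%n≡m i<n)

cyc-periodic : ∀ xs → Periodic (cyc xs) (length xs)
cyc-periodic []       i = refl
cyc-periodic (x ∷ xs) i = cong (nth (x ∷ xs)) (begin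
  (suc (length xs) + i) % suc (length xs) ≡⟨ cong (_% suc (length xs)) (+-comm (suc (length xs)) i) ⟩
  (i + suc (length xs)) % suc (length xs) ≡⟨ [m+n]%n≡m%n i (suc (length xs)) ⟩
  i % suc (length xs)                     ∎)
  where open ≡-Reasoning

cyc-++ˡ : ∀ xs ys {i} → i < length xs → cyc (xs ++ ys) i ≡ cyc xs i
cyc-++ˡ xs ys {i} i<n = begin
  cyc (xs ++ ys) i ≡⟨ cyc-nth (xs ++ ys) (subst (i <_) (sym (length-++ xs)) (≤-trans i<n (m≤m+n _ _))) ⟩
  nth (xs ++ ys) i ≡⟨ nth-++ˡ xs ys i<n ⟩
  nth xs i         ≡⟨ cyc-nth xs i<n ⟨
  cyc xs i         ∎
  where open ≡-Reasoning

cyc-++ʳ : ∀ xs ys {j} → j < length ys → cyc (xs ++ ys) (length xs + j) ≡ cyc ys j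
cyc-++ʳ xs ys {j} j<n = begin
  cyc (xs ++ ys) (length xs + j) ≡⟨ cyc-nth (xs ++ ys) (subst (length xs + j <_) (sym (length-++ xs)) (+-monoʳ-< (length xs) j<n)) ⟩
  nth (xs ++ ys) (length xs + j) ≡⟨ nth-++ʳ xs ys j ⟩
  nth ys j                       ≡⟨ cyc-nth ys j<n ⟨
  cyc ys j                       ∎
  where open ≡-Reasoning

applyUpTo-cyc : ∀ xs → applyUpTo (cyc xs) (length xs) ≡ xs
applyUpTo-cyc xs = go xs (cyc xs) (cyc-nth xs)
  where
  go : ∀ ys (f : ℕ → ℕ) → (∀ {i} → i < length ys → f i ≡ nth ys i) → applyUpTo f (length ys) ≡ ys
  go []       f f≡ = refl
  go (y ∷ ys) f f≡ = cong₂ _∷_ (f≡ (s≤s z≤n)) (go ys (f ∘ suc) (f≡ ∘ s≤s))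

Periodic-* : ∀ {s p} → Periodic s p → ∀ k → Periodic s (k * p)
Periodic-* per zero    i = refl
Periodic-* {s} {p} per (suc k) i = begin
  s ((p + k * p) + i) ≡⟨ cong s (+-assoc p (k * p) i) ⟩
  s (p + (k * p + i)) ≡⟨ per (k * p + i) ⟩
  s (k * p + i)       ≡⟨ Periodic-* per k i ⟩
  s i                 ∎
  where open ≡-Reasoning

Periodic-cancelˡ : ∀ {s p q} → Periodic s p → Periodic s (p + q) → Periodic s q
Periodic-cancelˡ {s} {p} {q} perₚ perₚ₊q i = begin
  s (q + i)       ≡⟨ perₚ (q + i) ⟨
  s (p + (q + i)) ≡⟨ cong s (+-assoc p q i) ⟨
  s (p + q + i)   ≡⟨ perₚ₊q i ⟩
  s i             ∎
  where open ≡-Reasoning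

IsEll-∣ : ∀ {s ℓ M} → IsEll s ℓ → 2 ∣ M → Periodic s M → ℓ ∣ M
IsEll-∣ {s} {ℓ@(suc _)} {M} (_ , 2∣ℓ , perℓ , minimal) 2∣M perM with M % ℓ in M%ℓ≡
... | zero  = m%n≡0⇒n∣m M ℓ M%ℓ≡
... | suc r = ⊥-elim (<⇒≱ (subst (_< ℓ) M%ℓ≡ (m%n<n M ℓ)) (minimal (suc r) (s≤s z≤n) 2∣rem perRem))
  where
  M≡ : M ≡ M / ℓ * ℓ + suc r
  M≡ = trans (m≡m%n+[m/n]*n M ℓ) (trans (cong (_+ M / ℓ * ℓ) M%ℓ≡) (+-comm (suc r) _))
  2∣rem : 2 ∣ suc r
  2∣rem = ∣m+n∣m⇒∣n (subst (2 ∣_) M≡ 2∣M) (∣n⇒∣m*n (M / ℓ) 2∣ℓ)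
  perRem : Periodic s (suc r)
  perRem = Periodic-cancelˡ (Periodic-* perℓ (M / ℓ)) (subst (Periodic s) M≡ perM)

Periodic-reflect : ∀ {s t n} → Periodic s n → Periodic t n →
                   (∀ {r} → r < n → s (n ∸ suc r) ≡ t r) →
                   ∀ k {j} → j < k * n → s (k * n ∸ suc j) ≡ t j
Periodic-reflect perₛ perₜ base zero ()
Periodic-reflect {s} {t} {n} perₛ perₜ base (suc k) {j} j<N with <⊎≡+ (k * n) j
... | inj₁ j<kn = begin
  s (n + k * n ∸ suc j)   ≡⟨ cong s (+-∸-assoc n j<kn) ⟩
  s (n + (k * n ∸ suc j)) ≡⟨ perₛ (k * n ∸ suc j) ⟩
  s (k * n ∸ suc j)       ≡⟨ Periodic-reflect perₛ perₜ base k j<kn ⟩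
  t j                     ∎
  where open ≡-Reasoning
... | inj₂ (r , refl) = begin
  s (n + k * n ∸ suc (k * n + r))     ≡⟨ cong (λ m → s (m ∸ suc (k * n + r))) (+-comm n (k * n)) ⟩
  s (k * n + n ∸ suc (k * n + r))     ≡⟨ cong (λ m → s (k * n + n ∸ m)) (+-suc (k * n) r) ⟨
  s (k * n + n ∸ (k * n + suc r))     ≡⟨ cong s ([m+n]∸[m+o]≡n∸o (k * n) n (suc r)) ⟩
  s (n ∸ suc r)                       ≡⟨ base r<n ⟩
  t r                                 ≡⟨ Periodic-* perₜ k r ⟨
  t (k * n + r)                       ∎
  where
  open ≡-Reasoning
  r<n : r < n
  r<n = +-cancelʳ-< (k * n) r n (subst (_< n + k * n) (+-comm (k * n) r) j<N)

cyc-reverse : ∀ xs {N j} → length xs ∣ N → j < N → cyc xs (N ∸ suc j) ≡ cyc (reverse xs) j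
cyc-reverse xs (divides k refl) = Periodic-reflect (cyc-periodic xs) perRev base k
  where
  perRev : Periodic (cyc (reverse xs)) (length xs)
  perRev = subst (Periodic (cyc (reverse xs))) (length-reverse xs) (cyc-periodic (reverse xs))
  base : ∀ {r} → r < length xs → cyc xs (length xs ∸ suc r) ≡ cyc (reverse xs) r
  base {r} r<n = begin
    cyc xs (length xs ∸ suc r)  ≡⟨ cyc-nth xs (∸-monoʳ-< (s≤s z≤n) r<n) ⟩
    nth xs (length xs ∸ suc r)  ≡⟨ nth-reverse xs r<n ⟨
    nth (reverse xs) r          ≡⟨ cyc-nth (reverse xs) (subst (r <_) (sym (length-reverse xs)) r<n) ⟨
    cyc (reverse xs) r          ∎
    where open ≡-Reasoning

sumUpTo : (ℕ → ℕ) → ℕ → ℕ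
sumUpTo f zero    = 0
sumUpTo f (suc n) = f 0 + sumUpTo (f ∘ suc) n

sumUpTo-cong : ∀ {f g} → (∀ i → f i ≡ g i) → ∀ n → sumUpTo f n ≡ sumUpTo g n
sumUpTo-cong f≗g zero    = refl
sumUpTo-cong f≗g (suc n) = cong₂ _+_ (f≗g 0) (sumUpTo-cong (f≗g ∘ suc) n)

sumUpTo-+ : ∀ f m n → sumUpTo f (m + n) ≡ sumUpTo f m + sumUpTo (λ i → f (m + i)) n
sumUpTo-+ f zero    n = refl
sumUpTo-+ f (suc m) n = trans (cong (f 0 +_) (sumUpTo-+ (f ∘ suc) m n)) (sym (+-assoc (f 0) _ _))

sumUpTo-periodic : ∀ {f p} → Periodic f p → ∀ q → sumUpTo f (q * p) ≡ q * sumUpTo f p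
sumUpTo-periodic             per zero    = refl
sumUpTo-periodic {f} {p} per (suc q) = begin
  sumUpTo f (p + q * p)                            ≡⟨ sumUpTo-+ f p (q * p) ⟩
  sumUpTo f p + sumUpTo (λ i → f (p + i)) (q * p)  ≡⟨ cong (sumUpTo f p +_) (sumUpTo-cong per (q * p)) ⟩
  sumUpTo f p + sumUpTo f (q * p)                  ≡⟨ cong (sumUpTo f p +_) (sumUpTo-periodic per q) ⟩
  sumUpTo f p + q * sumUpTo f p                    ∎
  where open ≡-Reasoning

evenSum : List ℕ → ℕ
evenSum []           = 0
evenSum (x ∷ [])     = x
evenSum (x ∷ _ ∷ xs) = x + evenSum xs

evenSum-++ : ∀ xs ys h → length xs ≡ h * 2 → evenSum (xs ++ ys) ≡ evenSum xs + evenSum ys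
evenSum-++ []           ys zero    _   = refl
evenSum-++ (x ∷ y ∷ xs) ys (suc h) len =
  trans (cong (x +_) (evenSum-++ xs ys h (suc-injective (suc-injective len)))) (sym (+-assoc x _ _))

evenSum≡sumUpTo : ∀ xs h → length xs ≡ h * 2 → evenSum xs ≡ sumUpTo (λ j → cyc xs (j * 2)) h
evenSum≡sumUpTo xs h len = go xs h len (λ j → cyc xs (j * 2)) agree
  where
  agree : ∀ {j} → j < h → cyc xs (j * 2) ≡ nth xs (j * 2)
  agree j<h = cyc-nth xs (subst (_ <_) (sym len) (*-monoˡ-< 2 j<h))
  go : ∀ ys h → length ys ≡ h * 2 → ∀ f → (∀ {j} → j < h → f j ≡ nth ys (j * 2)) → evenSum ys ≡ sumUpTo f h
  go []           zero    _   f f≡ = refl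
  go (y ∷ _ ∷ ys) (suc h) len f f≡ =
    cong₂ _+_ (sym (f≡ (s≤s z≤n))) (go ys h (suc-injective (suc-injective len)) (f ∘ suc) (f≡ ∘ s≤s))

*≡*+1⇒coprime : ∀ {u v x y} → u * x ≡ v * y + 1 → Coprime u v
*≡*+1⇒coprime {u} {v} {x} {y} eq {i} (i∣u , i∣v) =
  ∣1⇒≡1 (∣m+n∣m⇒∣n (subst (i ∣_) eq (∣m⇒∣m*n x i∣u)) (∣m⇒∣m*n y i∣v))

∣∧<⇒≡0 : ∀ {n t} → n ∣ t → t < n → t ≡ 0
∣∧<⇒≡0 {t = zero}  _   _   = refl
∣∧<⇒≡0 {t = suc _} n∣t t<n = ⊥-elim (>⇒∤ t<n n∣t)

residue-unique-≤ : ∀ {m n x x′ y y′ e f} → Coprime n m →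
                   n * x + e ≡ m * y + f → n * x′ + e ≡ m * y′ + f → y ≤ y′ → y′ < n → y ≡ y′
residue-unique-≤ {m} {n} {x} {x′} {y} {y′} {e} {f} cp eq eq′ y≤y′ y′<n with m≤n⇒∃[o]m+o≡n y≤y′
... | t , refl = sym (trans (cong (y +_) t≡0) (+-identityʳ y))
  where
  nx′≡nx+mt : n * x′ ≡ n * x + m * t
  nx′≡nx+mt = +-cancelʳ-≡ e _ _ (begin
    n * x′ + e              ≡⟨ eq′ ⟩
    m * (y + t) + f         ≡⟨ solve (m ∷ y ∷ t ∷ f ∷ []) ⟩
    (m * y + f) + m * t     ≡⟨ cong (_+ m * t) eq ⟨
    (n * x + e) + m * t     ≡⟨ solve (n ∷ x ∷ e ∷ m ∷ t ∷ []) ⟩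
    (n * x + m * t) + e     ∎)
    where open ≡-Reasoning
  t≡0 : t ≡ 0
  t≡0 = ∣∧<⇒≡0 (coprime-divisor cp (∣m+n∣m⇒∣n (subst (n ∣_) nx′≡nx+mt (m∣m*n x′)) (m∣m*n x)))
               (≤-<-trans (m≤n+m t y) y′<n)

residue-unique : ∀ {m n x x′ y y′ e f} → Coprime n m →
                 n * x + e ≡ m * y + f → n * x′ + e ≡ m * y′ + f → y < n → y′ < n → y ≡ y′
residue-unique cp eq eq′ y<n y′<n with ≤-total _ _
... | inj₁ y≤y′ = residue-unique-≤ cp eq eq′ y≤y′ y′<n
... | inj₂ y′≤y = sym (residue-unique-≤ cp eq′ eq y′≤y y<n)

Neighbors-2*<ˡ : ∀ {a b c d} → Neighbors a b c d → 2 * a < b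
Neighbors-2*<ˡ {a} {b} {c} {d} (_ , _ , bc≡ad+1 , 2c≤d) = *-cancelʳ-< d (2 * a) b (begin-strict
  2 * a * d       ≡⟨ *-assoc 2 a d ⟩
  2 * (a * d)     <⟨ *-monoʳ-< 2 (m<m+n (a * d) (s≤s z≤n)) ⟩
  2 * (a * d + 1) ≡⟨ cong (2 *_) bc≡ad+1 ⟨
  2 * (b * c)     ≡⟨ solve (b ∷ c ∷ []) ⟩
  b * (2 * c)     ≤⟨ *-monoʳ-≤ b 2c≤d ⟩
  b * d           ∎)
  where open ≤-Reasoning

Neighbors-mediantʳ : ∀ {a b c d} → Neighbors a b c d → Neighbors (a + c) (b + d) c d
Neighbors-mediantʳ {a} {b} {c} {d} (0<b , 0<d , bc≡ad+1 , 2c≤d) =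
  ≤-trans 0<b (m≤m+n b d) , 0<d , eq , 2c≤d
  where
  eq : (b + d) * c ≡ (a + c) * d + 1
  eq = begin
    (b + d) * c       ≡⟨ *-distribʳ-+ c b d ⟩
    b * c + d * c     ≡⟨ cong (_+ d * c) bc≡ad+1 ⟩
    a * d + 1 + d * c ≡⟨ solve (a ∷ c ∷ d ∷ []) ⟩
    (a + c) * d + 1   ∎
    where open ≡-Reasoning

Neighbors-mediantˡ : ∀ {a b c d} → Neighbors a b c d → Neighbors a b (a + c) (b + d)
Neighbors-mediantˡ {a} {b} {c} {d} nb@(0<b , 0<d , bc≡ad+1 , 2c≤d) =
  0<b , ≤-trans 0<b (m≤m+n b d) , eq , 2[a+c]≤b+d
  where
  eq : b * (a + c) ≡ a * (b + d) + 1
  eq = begin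
    b * (a + c)       ≡⟨ *-distribˡ-+ b a c ⟩
    b * a + b * c     ≡⟨ cong (b * a +_) bc≡ad+1 ⟩
    b * a + (a * d + 1) ≡⟨ solve (a ∷ b ∷ d ∷ []) ⟩
    a * (b + d) + 1   ∎
    where open ≡-Reasoning
  2[a+c]≤b+d : 2 * (a + c) ≤ b + d
  2[a+c]≤b+d = subst (_≤ b + d) (sym (*-distribˡ-+ 2 a c)) (+-mono-≤ (<⇒≤ (Neighbors-2*<ˡ {a} {b} {c} {d} nb)) 2c≤d)

Neighbors-unique-right : ∀ {m n c d c′ d′} → Neighbors m n c d → Neighbors m n c′ d′ →
                         d < n → d′ < n → c ≡ c′ × d ≡ d′
Neighbors-unique-right {m} {n} {c} {d} {c′} {d′} (0<n , _ , eq , _) (_ , _ , eq′ , _) d<n d′<n =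
  c≡c′ , d≡d′
  where
  instance _ = >-nonZero 0<n
  d≡d′ : d ≡ d′
  d≡d′ = residue-unique {m} {n} {c} {c′} {d} {d′} {0} {1} (*≡*+1⇒coprime eq)
                        (trans (+-identityʳ _) eq) (trans (+-identityʳ _) eq′) d<n d′<n
  c≡c′ : c ≡ c′
  c≡c′ = *-cancelˡ-≡ c c′ n (trans eq (trans (cong (λ k → m * k + 1) d≡d′) (sym eq′)))

Neighbors-unique-left : ∀ {a b a′ b′ m n} → Neighbors a b m n → Neighbors a′ b′ m n →
                        b < n → b′ < n → a ≡ a′ × b ≡ b′
Neighbors-unique-left {a} {b} {a′} {b′} {m} {n} (_ , 0<n , eq , _) (_ , _ , eq′ , _) b<n b′<n =
  a≡a′ , b≡b′
  where
  instance _ = >-nonZero 0<n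
  rearrange : ∀ {x y} → y * m ≡ x * n + 1 → n * x + 1 ≡ m * y + 0
  rearrange {x} {y} e = trans (cong (_+ 1) (*-comm n x)) (trans (sym e) (trans (*-comm y m) (sym (+-identityʳ _))))
  coprime : Coprime n m
  coprime = Coprime-sym (*≡*+1⇒coprime (trans (*-comm m b) (trans eq (cong (_+ 1) (*-comm a n)))))
  b≡b′ : b ≡ b′
  b≡b′ = residue-unique {m} {n} {a} {a′} {b} {b′} {1} {0} coprime (rearrange eq) (rearrange eq′) b<n b′<n
  a≡a′ : a ≡ a′
  a≡a′ = *-cancelˡ-≡ a a′ n (+-cancelʳ-≡ 1 _ _
           (trans (rearrange eq) (trans (cong (λ k → m * k + 0) b≡b′) (sym (rearrange eq′)))))

mediant-unique : ∀ {a b c d a′ b′ c′ d′} → Neighbors a b c d → Neighbors a′ b′ c′ d′ →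
                 a + c ≡ a′ + c′ → b + d ≡ b′ + d′ → a ≡ a′ × b ≡ b′ × c ≡ c′ × d ≡ d′
mediant-unique {a} {b} {c} {d} {a′} {b′} {c′} {d′} nb nb′ ac≡ bd≡
  with Neighbors-unique-right {a + c} {b + d} (Neighbors-mediantʳ {a} {b} {c} {d} nb)
         (subst₂ (λ m n → Neighbors m n c′ d′) (sym ac≡) (sym bd≡) (Neighbors-mediantʳ {a′} {b′} {c′} {d′} nb′))
         (m<n+m d (proj₁ nb)) (subst (d′ <_) (sym bd≡) (m<n+m d′ (proj₁ nb′)))
... | refl , refl = +-cancelʳ-≡ c a a′ ac≡ , +-cancelʳ-≡ d b b′ bd≡ , refl , refl

Neighbors⇒2≤b+d : ∀ {a b c d} → Neighbors a b c d → 2 ≤ b + d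
Neighbors⇒2≤b+d (0<b , 0<d , _) = +-mono-≤ 0<b 0<d

mediant≢1/2 : ∀ {a b c d} → Neighbors a b c d → a + c ≡ 1 → b + d ≢ 2
mediant≢1/2 {a} {b} {c} {d} nb a+c≡1 b+d≡2 =
  <-irrefl refl (subst₂ (λ x y → 2 * x < y) a+c≡1 b+d≡2 (Neighbors-2*<ˡ {a + c} (Neighbors-mediantʳ {a} {b} {c} {d} nb)))

Neighbors⇒≢ : ∀ {a b c d} → Neighbors a b c d → b ≢ d
Neighbors⇒≢ {a} {b} {c} {d} (_ , _ , bc≡ad+1 , 2c≤d) refl
  with ∣1⇒≡1 (∣m+n∣m⇒∣n (subst (b ∣_) bc≡ad+1 (m∣m*n c)) (n∣m*n a))
... | refl with c
...   | zero  = 0≢1+n (trans bc≡ad+1 (+-comm (a * 1) 1))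
...   | suc _ = <⇒≱ (s≤s (s≤s z≤n)) (≤-trans (*-monoʳ-≤ 2 (s≤s z≤n)) 2c≤d)

record BlockInvariants (a b : ℕ) (P : List ℕ) : Set where
  constructor invariants
  field
    half      : ℕ
    length≡   : length P ≡ half * 2
    half+a≡b  : half + a ≡ b
    evenSum≡b : evenSum P ≡ b
    coprime   : Coprime a b

BlockInvariants⇒IsEll≡length : ∀ {a b P ℓ} → BlockInvariants a b P → IsEll (cyc P) ℓ → ℓ ≡ length P
BlockInvariants⇒IsEll≡length {a} {b} {P} (invariants h len≡ h+a≡b evenSum≡b coprime)
  ell@(_ , divides ℓ′ refl , perℓ , _)
  with IsEll-∣ ell (divides h len≡) (cyc-periodic P)
... | divides q len≡qℓ = begin
  ℓ′ * 2       ≡⟨ *-identityˡ (ℓ′ * 2) ⟨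
  1 * (ℓ′ * 2) ≡⟨ cong (_* (ℓ′ * 2)) q≡1 ⟨
  q * (ℓ′ * 2) ≡⟨ len≡qℓ ⟨
  length P     ∎
  where
  open ≡-Reasoning
  h≡qℓ′ : h ≡ q * ℓ′
  h≡qℓ′ = *-cancelʳ-≡ h (q * ℓ′) 2 (trans (sym len≡) (trans len≡qℓ (sym (*-assoc q ℓ′ 2))))
  f : ℕ → ℕ
  f j = cyc P (j * 2)
  perf : Periodic f ℓ′
  perf j = trans (cong (cyc P) (*-distribʳ-+ 2 ℓ′ j)) (perℓ (j * 2))
  q∣b : q ∣ b
  q∣b = divides (sumUpTo f ℓ′) (begin
    b                  ≡⟨ evenSum≡b ⟨
    evenSum P          ≡⟨ evenSum≡sumUpTo P h len≡ ⟩
    sumUpTo f h        ≡⟨ cong (sumUpTo f) h≡qℓ′ ⟩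
    sumUpTo f (q * ℓ′) ≡⟨ sumUpTo-periodic perf q ⟩
    q * sumUpTo f ℓ′   ≡⟨ *-comm q _ ⟩
    sumUpTo f ℓ′ * q   ∎)
  q∣a : q ∣ a
  q∣a = ∣m+n∣m⇒∣n (subst (q ∣_) (sym h+a≡b) q∣b) (divides ℓ′ (trans h≡qℓ′ (*-comm q ℓ′)))
  q≡1 : q ≡ 1
  q≡1 = coprime (q∣a , q∣b)

mutual
  W-invariants : ∀ {a b P} → W a b P → BlockInvariants a b P
  W-invariants w0  = invariants 1 refl refl refl (λ (_ , i∣1) → ∣1⇒≡1 i∣1)
  W-invariants w12 = invariants 1 refl refl refl (λ (i∣1 , _) → ∣1⇒≡1 i∣1)
  W-invariants (wmed {a} {b} {c} {d} {P} {Q} nb wP wQ blockQ blockP)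
    with W-minBlock wQ blockQ | W-minBlock wP blockP | W-invariants wP | W-invariants wQ
  ... | refl | refl | invariants hP lenP hP+a≡b sumP _ | invariants hQ lenQ hQ+c≡d sumQ _ =
    invariants (hQ + hP) len≡ half+a≡b sum≡ coprime
    where
    len≡ : length (Q ++ P) ≡ (hQ + hP) * 2
    len≡ = trans (length-++ Q) (trans (cong₂ _+_ lenQ lenP) (sym (*-distribʳ-+ 2 hQ hP)))
    half+a≡b : hQ + hP + (a + c) ≡ b + d
    half+a≡b = begin
      hQ + hP + (a + c)   ≡⟨ solve (hQ ∷ hP ∷ a ∷ c ∷ []) ⟩
      (hP + a) + (hQ + c) ≡⟨ cong₂ _+_ hP+a≡b hQ+c≡d ⟩
      b + d               ∎
      where open ≡-Reasoning
    sum≡ : evenSum (Q ++ P) ≡ b + d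
    sum≡ = trans (evenSum-++ Q P hQ lenQ) (trans (cong₂ _+_ sumQ sumP) (+-comm d b))
    coprime : Coprime (a + c) (b + d)
    coprime = let (_ , _ , eq , _) = Neighbors-mediantʳ {a} {b} {c} {d} nb in Coprime-sym (*≡*+1⇒coprime eq)

  W-IsEll≡length : ∀ {a b P ℓ} → W a b P → IsEll (cyc P) ℓ → ℓ ≡ length P
  W-IsEll≡length w = BlockInvariants⇒IsEll≡length (W-invariants w)

  W-minBlock : ∀ {a b P B} → W a b P → MinBlock P B → B ≡ P
  W-minBlock {P = P} w (ℓ , ell , refl) = trans (cong (applyUpTo (cyc P)) (W-IsEll≡length w ell)) (applyUpTo-cyc P)

W-even : ∀ {a b P} → W a b P → 2 ∣ length P
W-even w = let open BlockInvariants (W-invariants w) in divides half length≡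

W-functional : ∀ {a b P a′ b′ P′} → W a b P → W a′ b′ P′ → a ≡ a′ → b ≡ b′ → P ≡ P′
W-functional w0  w0  _ _ = refl
W-functional w12 w12 _ _ = refl
W-functional w0  (wmed {a} nb _ _ _ _) _ 1≡b+d = ⊥-elim (<-irrefl 1≡b+d (Neighbors⇒2≤b+d {a} nb))
W-functional (wmed {a} nb _ _ _ _) w0  _ b+d≡1 = ⊥-elim (<-irrefl (sym b+d≡1) (Neighbors⇒2≤b+d {a} nb))
W-functional w12 (wmed {a} nb _ _ _ _) 1≡a+c 2≡b+d = ⊥-elim (mediant≢1/2 {a} nb (sym 1≡a+c) (sym 2≡b+d))
W-functional (wmed {a} nb _ _ _ _) w12 a+c≡1 b+d≡2 = ⊥-elim (mediant≢1/2 {a} nb a+c≡1 b+d≡2)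
W-functional (wmed nb wP wQ blockQ blockP) (wmed nb′ wP′ wQ′ blockQ′ blockP′) ac≡ bd≡
  with mediant-unique nb nb′ ac≡ bd≡
     | W-minBlock wQ blockQ | W-minBlock wP blockP | W-minBlock wQ′ blockQ′ | W-minBlock wP′ blockP′
... | refl , refl , refl , refl | refl | refl | refl | refl =
  cong₂ _++_ (W-functional wQ wQ′ refl refl) (W-functional wP wP′ refl refl)

cyc-++-agree : ∀ ys xs {k} → k ≤ length xs → (∀ {j} → j < k → cyc xs j ≡ cyc ys j) →
               ∀ {i} → i < length ys + k → cyc (ys ++ xs) i ≡ cyc ys i
cyc-++-agree ys xs {k} k≤n agree {i} i<m+k with <⊎≡+ (length ys) i
... | inj₁ i<m       = cyc-++ˡ ys xs i<m
... | inj₂ (j , refl) = begin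
  cyc (ys ++ xs) (length ys + j) ≡⟨ cyc-++ʳ ys xs (<-≤-trans j<k k≤n) ⟩
  cyc xs j                       ≡⟨ agree j<k ⟩
  cyc ys j                       ≡⟨ cyc-periodic ys j ⟨
  cyc ys (length ys + j)         ∎
  where
  open ≡-Reasoning
  j<k : j < k
  j<k = +-cancelˡ-< (length ys) j k i<m+k

record Fork (X Y : List ℕ) (α β : ℕ) : Set where
  constructor fork
  field
    index   : ℕ
    length≡ : length X ≡ 2 + index
    agree   : ∀ {i} → i < index → cyc X i ≡ cyc Y i
    atˡ     : cyc X index ≡ α
    atʳ     : cyc Y index ≡ β

  index<length : index < length X
  index<length = subst (index <_) (sym length≡) (s≤s (n≤1+n index))

  nonempty : 0 < length X
  nonempty = ≤-<-trans z≤n index<length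

Fork-++ˡ : ∀ {X Y α β} → Fork X Y α β → Fork (Y ++ X) Y α β
Fork-++ˡ {X} {Y} f@(fork m len≡ agree atˡ atʳ) = record
  { index   = length Y + m
  ; length≡ = trans (length-++ Y) (trans (cong (length Y +_) len≡) (trans (+-suc (length Y) _) (cong suc (+-suc (length Y) m))))
  ; agree   = cyc-++-agree Y X (<⇒≤ (Fork.index<length f)) agree
  ; atˡ     = trans (cyc-++ʳ Y X (Fork.index<length f)) atˡ
  ; atʳ     = trans (cyc-periodic Y m) atʳ
  }

Fork-++ʳ : ∀ {X Y α β} → 0 < length Y → Fork X Y α β → Fork X (Y ++ X) α β
Fork-++ʳ {X} {Y} 0<∣Y∣ f@(fork m len≡ agree atˡ atʳ) = record
  { index   = m
  ; length≡ = len≡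
  ; agree   = λ i<m → trans (agree i<m) (sym (Y++X≗Y (<⇒≤ i<m)))
  ; atˡ     = atˡ
  ; atʳ     = trans (Y++X≗Y ≤-refl) atʳ
  }
  where
  Y++X≗Y : ∀ {i} → i ≤ m → cyc (Y ++ X) i ≡ cyc Y i
  Y++X≗Y i≤m = cyc-++-agree Y X (<⇒≤ (Fork.index<length f)) agree (≤-<-trans i≤m (m<n+m m 0<∣Y∣))

mutual
  Neighbors⇒Fork : ∀ {a b c d P Q} → Neighbors a b c d → W a b P → W c d Q →
                   Fork P Q 1 2 × Fork (reverse Q) (reverse P) 2 1
  Neighbors⇒Fork {a} {b} {c} {d} nb wP wQ with <-cmp b d
  ... | tri≈ _ b≡d _ = ⊥-elim (Neighbors⇒≢ {a} nb b≡d)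
  ... | tri> _ _ d<b = Neighbors⇒Forkˡ nb wP wQ d<b
  ... | tri< b<d _ _ = Neighbors⇒Forkʳ nb wP wQ b<d

  Neighbors⇒Forkˡ : ∀ {a b c d P Q} → Neighbors a b c d → W a b P → W c d Q → d < b →
                    Fork P Q 1 2 × Fork (reverse Q) (reverse P) 2 1
  Neighbors⇒Forkˡ (_ , 0<d , _) w0 _ d<1 = ⊥-elim (<⇒≱ 0<d (≤-pred d<1))
  Neighbors⇒Forkˡ {c = c} {d} nb w12 _ _ = ⊥-elim (<-irrefl refl (Neighbors-2*<ˡ {1} {2} {c} {d} nb))
  Neighbors⇒Forkˡ {Q = Q} nb (wmed {a₁} {b₁} {c₁} {d₁} {P₁} nb₁ wP₁ wQ′ blockQ′ blockP₁) wQ d<b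
    with Neighbors-unique-right {a₁ + c₁} {b₁ + d₁} nb (Neighbors-mediantʳ {a₁} nb₁) d<b (m<n+m d₁ (proj₁ nb₁))
  ... | refl , refl with W-functional wQ′ wQ refl refl | W-minBlock wQ′ blockQ′ | W-minBlock wP₁ blockP₁
  ... | refl | refl | refl with Neighbors⇒Fork nb₁ wP₁ wQ
  ... | f , f′ =
    Fork-++ˡ f ,
    subst (λ R → Fork (reverse Q) R 2 1) (sym (reverse-++ Q P₁))
      (Fork-++ʳ (subst (0 <_) (sym (length-reverse P₁)) (Fork.nonempty f)) f′)

  Neighbors⇒Forkʳ : ∀ {a b c d P Q} → Neighbors a b c d → W a b P → W c d Q → b < d →
                    Fork P Q 1 2 × Fork (reverse Q) (reverse P) 2 1
  Neighbors⇒Forkʳ (0<b , _) _ w0 b<1 = ⊥-elim (<⇒≱ 0<b (≤-pred b<1))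
  Neighbors⇒Forkʳ _ w0 w12 _ = fork 0 refl (λ ()) refl refl , fork 0 refl (λ ()) refl refl
  Neighbors⇒Forkʳ nb w12 w12 _ = ⊥-elim (<-irrefl refl (Neighbors-2*<ˡ {1} {2} {1} {2} nb))
  Neighbors⇒Forkʳ _ (wmed {a} nb₁ _ _ _ _) w12 b<2 = ⊥-elim (<⇒≱ b<2 (Neighbors⇒2≤b+d {a} nb₁))
  Neighbors⇒Forkʳ {a} {b} {P = P} nb wP (wmed {a₂} {b₂} {c₂} {d₂} {P′} {Q₂} nb₂ wP′ wQ₂ blockQ₂ blockP′) b<d
    with Neighbors-unique-left {a} {b} {a₂} {b₂} {a₂ + c₂} {b₂ + d₂} nb (Neighbors-mediantˡ nb₂) b<d (m<m+n b₂ (proj₁ (proj₂ nb₂)))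
  ... | refl , refl with W-functional wP′ wP refl refl | W-minBlock wQ₂ blockQ₂ | W-minBlock wP′ blockP′
  ... | refl | refl | refl with Neighbors⇒Fork nb₂ wP wQ₂
  ... | f , f′ =
    Fork-++ʳ (subst (0 <_) (length-reverse Q₂) (Fork.nonempty f′)) f ,
    subst (λ R → Fork R (reverse P) 2 1) (sym (reverse-++ Q₂ P)) (Fork-++ˡ f′)

Fork⇒FMatch : ∀ {X Y α β} → α ≢ β → Fork X Y α β → FMatch (cyc X) (cyc Y) (length X ∸ 2)
Fork⇒FMatch α≢β (fork m len≡ agree atˡ atʳ) rewrite len≡ =
  (λ _ → agree) , λ eq → α≢β (trans (sym atˡ) (trans eq atʳ))

Fork⇒BMatch : ∀ {X Y α β} → α ≢ β → 0 < length X → 2 ∣ length X →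
              Fork (reverse Y) (reverse X) β α → BMatch (cyc X) (cyc Y) (length Y ∸ 2)
Fork⇒BMatch {X} {Y} α≢β 0<∣X∣ 2∣∣X∣ f@(fork m len≡ agree atˡ atʳ) =
  subst (BMatch (cyc X) (cyc Y)) m≡
    ( N , *-mono-< 0<∣X∣ 0<∣Y∣ , ∣m⇒∣m*n (length Y) 2∣∣X∣
    , perX , Periodic-* (cyc-periodic Y) (length X) , m<N
    , (λ j j<m → trans (reflectX (<-trans j<m m<N))
                   (trans (sym (agree j<m)) (sym (reflectY (<-trans j<m m<N)))))
    , (λ eq → α≢β (trans (sym atʳ) (trans (sym (reflectX m<N)) (trans eq (trans (reflectY m<N) atˡ))))) )
  where
  N = length X * length Y
  m≡ : m ≡ length Y ∸ 2
  m≡ = cong (_∸ 2) (trans (sym len≡) (length-reverse Y))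
  m<∣Y∣ : m < length Y
  m<∣Y∣ = subst (m <_) (length-reverse Y) (Fork.index<length f)
  0<∣Y∣ : 0 < length Y
  0<∣Y∣ = ≤-<-trans z≤n m<∣Y∣
  m<N : m < N
  m<N = <-≤-trans m<∣Y∣ (m≤n*m (length Y) (length X) {{>-nonZero 0<∣X∣}})
  perX : Periodic (cyc X) N
  perX = subst (Periodic (cyc X)) (*-comm (length Y) (length X)) (Periodic-* (cyc-periodic X) (length Y))
  reflectX : ∀ {j} → j < N → cyc X (N ∸ suc j) ≡ cyc (reverse X) j
  reflectX = cyc-reverse X (m∣m*n (length Y))
  reflectY : ∀ {j} → j < N → cyc Y (N ∸ suc j) ≡ cyc (reverse Y) j
  reflectY = cyc-reverse Y (n∣m*n (length X))

Fork⇒CFLess : ∀ {X Y α β} → 2 ∣ length X → α < β → Fork X Y α β → CFLess (cyc X) (cyc Y)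
Fork⇒CFLess 2∣∣X∣ α<β (fork m len≡ agree atˡ atʳ) =
  m , (λ _ → agree) , inj₁ (∣m+n∣m⇒∣n (subst (2 ∣_) len≡ 2∣∣X∣) (n∣n {2}) , subst₂ _<_ (sym atˡ) (sym atʳ) α<β)

≢-of-order : ∀ {A B : Set} {x y} → (A × x < y) ⊎ (B × y < x) → x ≢ y
≢-of-order (inj₁ (_ , x<y)) refl = <-irrefl refl x<y
≢-of-order (inj₂ (_ , y<x)) refl = <-irrefl refl y<x

CFLess-asym : ∀ {s t} → CFLess s t → ¬ CFLess t s
CFLess-asym (k , agree , order) (k′ , agree′ , order′) with <-cmp k k′
... | tri< k<k′ _ _ = ≢-of-order order  (sym (agree′ k k<k′))
... | tri> _ _ k′<k = ≢-of-order order′ (sym (agree k′ k′<k))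
... | tri≈ _ refl _ with order | order′
...   | inj₁ (_ , s<t)   | inj₁ (_ , t<s)    = <-asym s<t t<s
...   | inj₂ (_ , t<s)   | inj₂ (_ , s<t)    = <-asym s<t t<s
...   | inj₁ (2∣k , _)   | inj₂ (2∤k , _)    = 2∤k 2∣k
...   | inj₂ (2∤k , _)   | inj₁ (2∣k , _)    = 2∤k 2∣k

lemma6p6 : ∀ {a b c d : ℕ} {P Q : List ℕ}
    → (Neighbors a b c d ⊎ Neighbors c d a b)
    → W a b P → W c d Q
    → CFLess (cyc P) (cyc Q)
    → ∀ (ℓu ℓv : ℕ) → IsEll (cyc P) ℓu → IsEll (cyc Q) ℓv
    → BMatch (cyc P) (cyc Q) (ℓv ∸ 2) × FMatch (cyc P) (cyc Q) (ℓu ∸ 2)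
lemma6p6 {P = P} {Q} (inj₁ nb) wP wQ _ _ _ ellP ellQ
  with W-IsEll≡length wP ellP | W-IsEll≡length wQ ellQ | Neighbors⇒Fork nb wP wQ
... | refl | refl | forward , backward =
  Fork⇒BMatch {P} {Q} (λ ()) (Fork.nonempty forward) (W-even wP) backward , Fork⇒FMatch (λ ()) forward
lemma6p6 (inj₂ nb) wP wQ P<Q _ _ _ _ = ⊥-elim (
  CFLess-asym P<Q (Fork⇒CFLess (W-even wQ) (s≤s (s≤s z≤n)) (proj₁ (Neighbors⇒Fork nb wQ wP))))
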